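{- Let $G_0,G_1\in\mathbb{Z}$, let $(G_n)_{n\ge0}$ satisfy $G_n=G_{n-1}+G_{n-2}$ for $n\ge2$, let $k$ be a positive integer and $m\ge2$ an integer. Then $\pi_{G_0,G_1}(m)$ divides $k$ if and only if $m$ divides $\mathcal{G}_{G_0,G_1}(k)$.
   Context: $\mathcal{G}_{G_0,G_1}(k)$ is the greatest common divisor of all integers $\sum_{i=0}^{k-1}G_{n+i}$, $n\ge1$. For $m\ge2$, the generalized Pisano period $\pi_{G_0,G_1}(m)$ is the smallest positive integer $r$ with $G_r\equiv G_0\pmod m$ and $G_{r+1}\equiv G_1\pmod m$. -}

module Defs where

open import Data.Nat as ℕ using (ℕ; zero; suc; _≤_; _<_)
open import Data.Integer as ℤ using (ℤ; +_; _-_)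
open import Data.Integer.Divisibility as ℤD using ()
open import Data.Nat.Divisibility as ℕD using ()

G : ℤ → ℤ → ℕ → ℤ
G G₀ G₁ zero = G₀
G G₀ G₁ (suc zero) = G₁
G G₀ G₁ (suc (suc n)) = G G₀ G₁ (suc n) ℤ.+ G G₀ G₁ n

windowSum : ℤ → ℤ → ℕ → ℕ → ℤ
windowSum G₀ G₁ zero n = + 0
windowSum G₀ G₁ (suc k) n = G G₀ G₁ n ℤ.+ windowSum G₀ G₁ k (suc n)

_≡_[mod_] : ℤ → ℤ → ℕ → Set
a ≡ b [mod m ] = (+ m) ℤD.∣ (a - b)

-- g is the greatest common divisor (nonnegative, w.r.t. divisibility) of all
-- integers Σ_{i=0}^{k-1} G_{n+i}, n ≥ 1; i.e. g = 𝒢_{G₀,G₁}(k).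
IsSumGCD : ℤ → ℤ → ℕ → ℕ → Set
IsSumGCD G₀ G₁ k g =
  (∀ n → 1 ≤ n → (+ g) ℤD.∣ windowSum G₀ G₁ k n) ×'
  (∀ (d : ℕ) → (∀ n → 1 ≤ n → (+ d) ℤD.∣ windowSum G₀ G₁ k n) → d ℕD.∣ g)
  where open import Data.Product renaming (_×_ to _×'_)

IsPisanoPeriod : ℤ → ℤ → ℕ → ℕ → Set
IsPisanoPeriod G₀ G₁ m r =
  (1 ≤ r) ×' (G G₀ G₁ r ≡ G₀ [mod m ]) ×' (G G₀ G₁ (suc r) ≡ G₁ [mod m ]) ×'
  (∀ s → 1 ≤ s → G G₀ G₁ s ≡ G₀ [mod m ] → G G₀ G₁ (suc s) ≡ G₁ [mod m ] → r ≤ s)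
  where open import Data.Product renaming (_×_ to _×'_)

{-# OPTIONS --safe #-}
-- The window sums telescope: Σ_{i<k} G_{n+i} = G_{n+k+1} − G_{n+1}. So m divides all of
-- them (n ≥ 1) exactly when G shifted by k agrees with G mod m from index 2 on, and since
-- the recurrence can be run backwards, exactly when k is a period of G mod m. The periods
-- mod m form a submonoid of ℕ closed under differences, so they are the multiples of the
-- least positive one, which is π(m).
module Submission where

open import Defs
open import Data.Nat using (ℕ; zero; suc; _+_; _*_; _≤_; s≤s; z≤n; >-nonZero; NonZero)
open import Data.Nat.Divisibility using (_∣_; divides; m%n≡0⇒n∣m; ∣-trans)
open import Function.Bundles using (_⇔_; mk⇔)

open import Data.Empty using (⊥-elim)
open import Data.List using ([]; _∷_)
open import Data.Nat.DivMod using (_%_; _/_; m≡m%n+[m/n]*n; m%n<n)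
open import Data.Nat.Properties using (+-assoc; +-suc; +-identityʳ; <⇒≱)
open import Data.Integer as ℤ using (ℤ; +_; _-_)
open import Data.Integer.Divisibility.Signed as ℤ∣
  using (∣ᵤ⇒∣; ∣⇒∣ᵤ; ∣m∣n⇒∣m+n; ∣m∣n⇒∣m-n; ∣m⇒∣-m)
open import Data.Integer.Properties using (+-inverseʳ; +-minus-telescope)
import Data.Integer.Divisibility as ℤᵘ
open import Data.Integer.Tactic.RingSolver using (solve; solve-∀)
open import Data.Product using (_×_; _,_; proj₁)
open import Relation.Binary.PropositionalEquality using (_≡_; refl; sym; cong; subst; subst₂; module ≡-Reasoning)

module Congruence (m : ℕ) where

  infix 4 _≈_

  -- A record, so that the two sides can be inferred from a proof.
  record _≈_ (a b : ℤ) : Set where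
    constructor mk≈
    field +m∣a-b : + m ℤ∣.∣ a - b

  ≡[mod]⇒≈ : ∀ {a b} → a ≡ b [mod m ] → a ≈ b
  ≡[mod]⇒≈ p = mk≈ (∣ᵤ⇒∣ p)

  ≈⇒≡[mod] : ∀ {a b} → a ≈ b → a ≡ b [mod m ]
  ≈⇒≡[mod] (mk≈ p) = ∣⇒∣ᵤ p

  ≈-refl : ∀ {a} → a ≈ a
  ≈-refl {a} = mk≈ (ℤ∣.divides (+ 0) (+-inverseʳ a))

  ≈-sym : ∀ {a b} → a ≈ b → b ≈ a
  ≈-sym {a} {b} (mk≈ p) =
    mk≈ (subst (+ m ℤ∣.∣_) -[a-b]≡b-a (∣m⇒∣-m p))
    where
    -[a-b]≡b-a : ℤ.- (a - b) ≡ b - a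
    -[a-b]≡b-a = solve (a ∷ b ∷ [])

  ≈-trans : ∀ {a b c} → a ≈ b → b ≈ c → a ≈ c
  ≈-trans {a} {b} {c} (mk≈ p) (mk≈ q) =
    mk≈ (subst (+ m ℤ∣.∣_) (+-minus-telescope a b c) (∣m∣n⇒∣m+n p q))

  +-cong : ∀ {a b c d} → a ≈ b → c ≈ d → a ℤ.+ c ≈ b ℤ.+ d
  +-cong {a} {b} {c} {d} (mk≈ p) (mk≈ q) =
    mk≈ (subst (+ m ℤ∣.∣_) interchange (∣m∣n⇒∣m+n p q))
    where
    interchange : (a - b) ℤ.+ (c - d) ≡ (a ℤ.+ c) - (b ℤ.+ d)
    interchange = solve (a ∷ b ∷ c ∷ d ∷ [])

  minus-cong : ∀ {a b c d} → a ≈ b → c ≈ d → a - c ≈ b - d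
  minus-cong {a} {b} {c} {d} (mk≈ p) (mk≈ q) =
    mk≈ (subst (+ m ℤ∣.∣_) interchange (∣m∣n⇒∣m-n p q))
    where
    interchange : (a - b) - (c - d) ≡ (a - c) - (b - d)
    interchange = solve (a ∷ b ∷ c ∷ d ∷ [])

module DifferenceClosedSubmonoid {p} (P : ℕ → Set p)
         (P-zero : P 0)
         (P-+ : ∀ {a b} → P a → P b → P (a + b))
         (P-cancelʳ : ∀ {a b} → P a → P (b + a) → P b) where

  P-* : ∀ q {a} → P a → P (q * a)
  P-* zero    Pa = P-zero
  P-* (suc q) Pa = P-+ Pa (P-* q Pa)

  least-positive-divides : ∀ {r k} → 1 ≤ r → P r → (∀ s → 1 ≤ s → P s → r ≤ s) →
                           P k → r ∣ k
  least-positive-divides {r} {k} r≥1 Pr least Pk = m%n≡0⇒n∣m k r remainder≡0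
    where
    instance
      r≢0 : NonZero r
      r≢0 = >-nonZero r≥1

    P-remainder : P (k % r)
    P-remainder = P-cancelʳ (P-* (k / r) Pr) (subst P (m≡m%n+[m/n]*n k r) Pk)

    remainder≡0 : k % r ≡ 0
    remainder≡0 with k % r | P-remainder | m%n<n k r
    ... | zero  | _  | _   = refl
    ... | suc s | Ps | s<r = ⊥-elim (<⇒≱ s<r (least (suc s) (s≤s z≤n) Ps))

module Fibonacci (G₀ G₁ : ℤ) where

  F : ℕ → ℤ
  F = G G₀ G₁

  F-pred : ∀ n → F (suc (suc n)) - F (suc n) ≡ F n
  F-pred n = cancel (F (suc n)) (F n)
    where
    cancel : ∀ x y → (x ℤ.+ y) - x ≡ y
    cancel = solve-∀

  windowSum≡ : ∀ k n → windowSum G₀ G₁ k n ≡ F (suc n + k) - F (suc n)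
  windowSum≡ zero n rewrite +-identityʳ n = sym (+-inverseʳ (F (suc n)))
  windowSum≡ (suc k) n = begin
    F n ℤ.+ windowSum G₀ G₁ k (suc n)                ≡⟨ cong (λ x → F n ℤ.+ x) (windowSum≡ k (suc n)) ⟩
    F n ℤ.+ (F (suc (suc n) + k) - F (suc (suc n)))  ≡⟨ cancel (F n) (F (suc (suc n) + k)) (F (suc n)) ⟩
    F (suc (suc n) + k) - F (suc n)                  ≡⟨ cong (λ i → F (suc i) - F (suc n)) (+-suc n k) ⟨
    F (suc n + suc k) - F (suc n)                    ∎
    where
    open ≡-Reasoning
    cancel : ∀ x y z → x ℤ.+ (y - (z ℤ.+ x)) ≡ y - z
    cancel = solve-∀

  module Periodicity (m : ℕ) where
    open Congruence m

    IsPeriod : ℕ → Set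
    IsPeriod a = ∀ j → F (j + a) ≈ F j

    shift-step : ∀ {a} j → F (j + a) ≈ F j → F (suc j + a) ≈ F (suc j) →
                 F (suc (suc j) + a) ≈ F (suc (suc j))
    shift-step j p q = +-cong q p

    shift-step⁻¹ : ∀ {a} j → F (suc j + a) ≈ F (suc j) → F (suc (suc j) + a) ≈ F (suc (suc j)) →
                   F (j + a) ≈ F j
    shift-step⁻¹ {a} j p q = subst₂ _≈_ (F-pred (j + a)) (F-pred j) (minus-cong q p)

    initial-agreement : ∀ {a} j → F (j + a) ≈ F j → F (suc j + a) ≈ F (suc j) →
                        F a ≈ G₀ × F (suc a) ≈ G₁
    initial-agreement zero    p q = p , q
    initial-agreement (suc j) p q = initial-agreement j (shift-step⁻¹ j p q) p

    isPeriod-from-initial : ∀ {a} → F a ≈ G₀ × F (suc a) ≈ G₁ → IsPeriod a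
    isPeriod-from-initial {a} (p , q) j = proj₁ (agreement j)
      where
      agreement : ∀ j → F (j + a) ≈ F j × F (suc j + a) ≈ F (suc j)
      agreement zero    = p , q
      agreement (suc j) = let (p′ , q′) = agreement j in q′ , shift-step j p′ q′

    isPeriod-zero : IsPeriod 0
    isPeriod-zero j rewrite +-identityʳ j = ≈-refl

    isPeriod-+ : ∀ {a b} → IsPeriod a → IsPeriod b → IsPeriod (a + b)
    isPeriod-+ {a} {b} Pa Pb j rewrite sym (+-assoc j a b) = ≈-trans (Pb (j + a)) (Pa j)

    isPeriod-cancelʳ : ∀ {a b} → IsPeriod a → IsPeriod (b + a) → IsPeriod b
    isPeriod-cancelʳ {a} {b} Pa Pba j =
      ≈-trans (≈-sym (Pa (j + b))) (subst (λ i → F i ≈ F j) (sym (+-assoc j b a)) (Pba j))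

    open DifferenceClosedSubmonoid IsPeriod isPeriod-zero isPeriod-+ isPeriod-cancelʳ public
      renaming (P-* to isPeriod-*; least-positive-divides to least-period-divides)

    ∣windowSum⇒≈ : ∀ k n → + m ℤᵘ.∣ windowSum G₀ G₁ k n → F (suc n + k) ≈ F (suc n)
    ∣windowSum⇒≈ k n m∣w = ≡[mod]⇒≈ (subst (+ m ℤᵘ.∣_) (windowSum≡ k n) m∣w)

    ≈⇒∣windowSum : ∀ k n → F (suc n + k) ≈ F (suc n) → + m ℤᵘ.∣ windowSum G₀ G₁ k n
    ≈⇒∣windowSum k n p = subst (+ m ℤᵘ.∣_) (sym (windowSum≡ k n)) (≈⇒≡[mod] p)

theorem3p10 : (G₀ G₁ : ℤ) (k m : ℕ) → 1 ≤ k → 2 ≤ m →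
    (r g : ℕ) → IsPisanoPeriod G₀ G₁ m r → IsSumGCD G₀ G₁ k g →
    (r ∣ k) ⇔ (m ∣ g)
theorem3p10 G₀ G₁ k m _ _ r g (r≥1 , Fr≡G₀ , F[1+r]≡G₁ , r-least) (g∣sums , g-greatest) =
  mk⇔ to from
  where
  open Fibonacci G₀ G₁
  open Periodicity m
  open Congruence m

  period-r : IsPeriod r
  period-r = isPeriod-from-initial (≡[mod]⇒≈ Fr≡G₀ , ≡[mod]⇒≈ F[1+r]≡G₁)

  to : r ∣ k → m ∣ g
  to (divides q refl) = g-greatest m λ n _ → ≈⇒∣windowSum k n (isPeriod-* q period-r (suc n))

  from : m ∣ g → r ∣ k
  from m∣g = least-period-divides r≥1 period-r least period-k
    where
    agree : ∀ n → 1 ≤ n → F (suc n + k) ≈ F (suc n)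
    agree n n≥1 = ∣windowSum⇒≈ k n (∣-trans m∣g (g∣sums n n≥1))

    period-k : IsPeriod k
    period-k = isPeriod-from-initial (initial-agreement {k} 2 (agree 1 (s≤s z≤n)) (agree 2 (s≤s z≤n)))

    least : ∀ s → 1 ≤ s → IsPeriod s → r ≤ s
    least s s≥1 Ps = r-least s s≥1 (≈⇒≡[mod] (Ps 0)) (≈⇒≡[mod] (Ps 1))
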